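{- Let $E=\{0,1,\dots,n\}$, let $M$ be a loopless matroid of rank $r+1$ on $E$, and let $1\le k\le n$. Then the following identities hold in $A^1(M)$: (1) for any subset $T\subseteq E$ with $|T|=n+1-k$, $\gamma_k=\sum_{S}\mathrm{OI}_E(S,T)\,x_S$; (2) $\gamma_k=\sum_{S}\mathrm{mult}_E(|S|,k)\,x_S$, where both sums range over nonempty proper subsets $S\subsetneq E$.
   Context: The Chow ring $A^*(M)$ (real coefficients) is $\mathbb{R}[x_F : F \text{ a nonempty proper flat of } M]$ modulo the ideal generated by all $x_{F_1}x_{F_2}$ with $F_1,F_2$ incomparable and all $\sum_{F\ni i}x_F-\sum_{F\ni j}x_F$ for $i,j\in E$. For any subset $S\subseteq E$, $x_S$ denotes the generator $x_S$ if $S$ is a nonempty proper flat of $M$ and $0$ otherwise. For $u\in\mathbb{R}^E$ and $S\subseteq E$ write $e_S=\sum_{i\in S}e_i$. The hypersimplex class $\gamma_k\in A^1(M)$ is defined as $\gamma_k=-\sum_{S}\varphi(e_S)x_S$ (sum over nonempty proper $S\subsetneq E$), where $\varphi(u)=\min_{U\subseteq E,\,|U|=n+1-k}(u\cdot e_U)-u\cdot w$ for a vector $w\in\mathbb{R}^E$ whose coordinates sum to $n+1-k$; the resulting class does not depend on the choice of such $w$. For a finite set $U$ and $S,T\subseteq U$, the over-intersection is $\mathrm{OI}_U(S,T)=|S\cap T|-\max(0,|S|+|T|-|U|)$, and for an integer $k$, $\mathrm{mult}_U(|S|,k)=\min(|S|,k)-\frac{k}{|U|}|S|$.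
   Formalization: The Chow ring is taken with rational rather than real coefficients, and the vector w in the definition of γ_k has rational coordinates. -}

module Defs where

open import Level using (0ℓ)
open import Data.Bool using (Bool; true; false; if_then_else_)
open import Data.Nat as ℕ using (ℕ; zero; suc; _≤_; _<_; _≡ᵇ_; _≤ᵇ_)
open import Data.Integer as ℤ using (ℤ; +_)
open import Data.Fin using (Fin)
open import Data.Fin.Subset using (Subset; _∪_; _∩_; ∣_∣; ⁅_⁆; _⊆_; _∈_; _∉_; ⊤)
open import Data.Vec using (Vec; []; _∷_; lookup)
open import Data.List using (List; []; _∷_; _++_; map; foldr; filter; allFin)
open import Data.Product using (_×_)
open import Relation.Binary.PropositionalEquality using (_≡_)
open import Relation.Nullary using (¬_)
open import Relation.Nullary.Decidable using (Dec; yes; no)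
open import Data.Rational as ℚ using (ℚ; 0ℚ; 1ℚ; _⊓_)
open import Data.Rational.Properties as ℚP using ()
open import Algebra.Bundles using (CommutativeRing)
open import Algebra.Morphism.Structures using (module RingMorphisms)

record Matroid (N : ℕ) : Set where
  field
    rk        : Subset N → ℕ
    rk-bound  : ∀ X → rk X ≤ ∣ X ∣
    rk-mono   : ∀ X Y → X ⊆ Y → rk X ≤ rk Y
    rk-submod : ∀ X Y → rk (X ∪ Y) ℕ.+ rk (X ∩ Y) ≤ rk X ℕ.+ rk Y

open Matroid public

Loopless : ∀ {N} → Matroid N → Set
Loopless {N} M = ∀ (i : Fin N) → rk M ⁅ i ⁆ ≡ 1

IsFlat : ∀ {N} → Matroid N → Subset N → Set
IsFlat {N} M F = ∀ (i : Fin N) → i ∉ F → rk M F < rk M (F ∪ ⁅ i ⁆)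

NonemptyProper : ∀ {N} → Subset N → Set
NonemptyProper {N} S = (1 ≤ ∣ S ∣) × (∣ S ∣ < N)

isNonemptyProperᵇ : ∀ {N} → Subset N → Bool
isNonemptyProperᵇ {N} S = (1 ≤ᵇ ∣ S ∣) Data.Bool.∧ (suc ∣ S ∣ ≤ᵇ N)
  where import Data.Bool

allSubsets : (N : ℕ) → List (Subset N)
allSubsets zero    = [] ∷ []
allSubsets (suc N) = map (true ∷_) (allSubsets N) ++ map (false ∷_) (allSubsets N)

nonemptyProperSubsets : (N : ℕ) → List (Subset N)
nonemptyProperSubsets N = filterᵇ isNonemptyProperᵇ (allSubsets N)
  where
  filterᵇ : ∀ {A : Set} → (A → Bool) → List A → List A
  filterᵇ p []       = []
  filterᵇ p (x ∷ xs) = if p x then x ∷ filterᵇ p xs else filterᵇ p xs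

subsetsOfSize : (N m : ℕ) → List (Subset N)
subsetsOfSize N m = filterᵇ (allSubsets N)
  where
  filterᵇ : List (Subset N) → List (Subset N)
  filterᵇ []       = []
  filterᵇ (x ∷ xs) = if ∣ x ∣ ≡ᵇ m then x ∷ filterᵇ xs else filterᵇ xs

ℕ→ℚ : ℕ → ℚ
ℕ→ℚ n = ℤ.+ n ℚ./ 1

sumℚ : List ℚ → ℚ
sumℚ = foldr ℚ._+_ 0ℚ

-- minimum of a (nonempty) list of rationals; the empty case is never used
minℚ : List ℚ → ℚ
minℚ []       = 0ℚ
minℚ (x ∷ xs) = foldr _⊓_ x xs

e : ∀ {N} → Subset N → Fin N → ℚ
e S i = if lookup S i then 1ℚ else 0ℚ

dot : ∀ {N} → (Fin N → ℚ) → (Fin N → ℚ) → ℚ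
dot {N} u v = sumℚ (map (λ i → u i ℚ.* v i) (allFin N))

φ : (n k : ℕ) → (w : Fin (suc n) → ℚ) → (Fin (suc n) → ℚ) → ℚ
φ n k w u = minℚ (map (λ U → dot u (e U)) (subsetsOfSize (suc n) (suc n ℕ.∸ k))) ℚ.- dot u w

-- coefficient of x_S in γ_k = −Σ_S φ(e_S) x_S
γcoeff : (n k : ℕ) → (w : Fin (suc n) → ℚ) → Subset (suc n) → ℚ
γcoeff n k w S = ℚ.- φ n k w (e S)

OI : ∀ {N} → Subset N → Subset N → ℚ
OI {N} S T = ℕ→ℚ ∣ S ∩ T ∣ ℚ.- (0ℚ ℚ.⊔ ((ℕ→ℚ ∣ S ∣ ℚ.+ ℕ→ℚ ∣ T ∣) ℚ.- ℕ→ℚ N))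

mult : (n : ℕ) → ℕ → ℕ → ℚ
mult n s k = (ℕ→ℚ s ⊓ ℕ→ℚ k) ℚ.- ((ℤ.+ k ℚ./ suc n) ℚ.* ℕ→ℚ s)

-- Equality in A^1(M) (degree-1 part of the Chow ring, rational coefficients),
-- expressed via the universal property of the quotient ring
--   ℚ[x_F : F nonempty proper flat] / I.
-- A "model" of A^*(M) is a commutative ring R with a ring map ℚ → R and
-- elements x_S ∈ R for every S ⊆ E such that x_S = 0 unless S is a nonempty
-- proper flat (the convention of the paper) and the defining relations hold.

ℚ-ring : CommutativeRing 0ℓ 0ℓ
ℚ-ring = ℚP.+-*-commutativeRing

record ChowModel {N : ℕ} (M : Matroid N) (R : CommutativeRing 0ℓ 0ℓ) : Set where
  open CommutativeRing R
  open RingMorphisms (CommutativeRing.rawRing ℚ-ring) rawRing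
  field
    ι      : ℚ → Carrier
    ι-hom  : IsRingHomomorphism ι
    x      : Subset N → Carrier
    x-zero : ∀ S → ¬ (NonemptyProper S × IsFlat M S) → x S ≈ 0#
    incomp : ∀ F₁ F₂ → NonemptyProper F₁ → IsFlat M F₁ → NonemptyProper F₂ → IsFlat M F₂ →
             ¬ (F₁ ⊆ F₂) → ¬ (F₂ ⊆ F₁) → x F₁ * x F₂ ≈ 0#
    linear : ∀ (i j : Fin N) →
             foldr _+_ 0# (map (λ F → if lookup F i then x F else 0#) (nonemptyProperSubsets N))
           ≈ foldr _+_ 0# (map (λ F → if lookup F j then x F else 0#) (nonemptyProperSubsets N))

evalLin : ∀ {N} {M : Matroid N} {R : CommutativeRing 0ℓ 0ℓ} →
          ChowModel M R → (Subset N → ℚ) → CommutativeRing.Carrier R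
evalLin {N} {M} {R} mdl c =
  foldr _+_ 0# (map (λ S → ι (c S) * x S) (nonemptyProperSubsets N))
  where open CommutativeRing R
        open ChowModel mdl

EqA1 : ∀ {N} → Matroid N → (c d : Subset N → ℚ) → Set₁
EqA1 {N} M c d = ∀ (R : CommutativeRing 0ℓ 0ℓ) (mdl : ChowModel M R) →
  CommutativeRing._≈_ R (evalLin mdl c) (evalLin mdl d)

{-# OPTIONS --safe #-}
-- φ(e_S) is the least overlap of S with an (n+1−k)-set minus e_S·w, i.e. max(0, |S| − k) − e_S·w,
-- so γ_k has coefficients e_S·w − max(0, |S| − k).  Both OI_E(S,T) and mult_E(|S|,k) differ from
-- these coefficients by e_S·a for a vector a with Σᵢ aᵢ = 0 (a = w − e_T, resp.
-- a = w − (1 − k/(n+1))·e_E), and such forms vanish in A¹(M): Σ_S (e_S·a) x_S = Σᵢ aᵢ Σ_{F∋i} x_F,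
-- and by the linear relations Σ_{F∋i} x_F does not depend on i.
module Submission where

open import Defs
open import Level using (0ℓ)
open import Function using (_∘_)
open import Algebra.Bundles using (Monoid; CommutativeRing)
open import Algebra.Morphism.Structures using (module RingMorphisms)
import Algebra.Properties.Monoid.Sum as MonoidSum
import Algebra.Properties.Semiring.Sum as SemiringSum
open import Data.Bool using (true; false; if_then_else_; _∧_)
open import Data.Nat as ℕ using (ℕ; zero; suc; z≤n; s≤s; _≤_; _∸_; _≟_; _≡ᵇ_)
import Data.Nat.Properties as ℕP
open import Data.Integer as ℤ using (+_)
import Data.Integer.Properties as ℤP
import Data.Nat.Coprimality as Coprimality
open import Data.Rational as ℚ using (ℚ; mkℚ; 0ℚ; 1ℚ; _⊓_; _⊔_; *≤*)
import Data.Rational.Properties as ℚP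
import Data.Rational.Unnormalised as ℚᵘ
import Data.Rational.Unnormalised.Properties as ℚᵘP
open import Data.Rational.Solver using (module +-*-Solver)
open import Data.Fin using (Fin; zero; suc)
open import Data.Fin.Subset using (Subset; ∣_∣; _∩_; ⊤)
import Data.Fin.Subset.Properties as SubsetP
open import Data.Vec using ([]; _∷_; lookup)
import Data.Vec.Properties as VecP
open import Data.List as List using (List; []; _∷_; map; foldr; allFin; filter; length)
import Data.List.Properties as ListP
open import Data.List.Membership.Propositional using (_∈_)
open import Data.List.Membership.Propositional.Properties
  using (∈-map⁺; ∈-++⁺ˡ; ∈-++⁺ʳ; ∈-filter⁺; ∈-filter⁻)
open import Data.List.Relation.Unary.All as All using (All)
import Data.List.Relation.Unary.All.Properties as AllP
open import Data.List.Relation.Unary.Any as Any using (here; there)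
open import Data.Product using (_×_; _,_; ∃; proj₂)
open import Data.Sum using (_⊎_; inj₁; inj₂; [_,_])
open import Relation.Binary.PropositionalEquality
  using (_≡_; refl; sym; trans; cong; cong₂; subst; subst₂; module ≡-Reasoning)
import Relation.Binary.Reasoning.Setoid as ≈-Reasoning

open +-*-Solver

ℕ→ℚ≡mkℚ : ∀ a → ℕ→ℚ a ≡ mkℚ (+ a) 0 (Coprimality.sym (Coprimality.1-coprimeTo a))
ℕ→ℚ≡mkℚ a = ℚP.normalize-coprime (Coprimality.sym (Coprimality.1-coprimeTo a))

ℕ→ℚ-+ : ∀ a b → ℕ→ℚ (a ℕ.+ b) ≡ ℕ→ℚ a ℚ.+ ℕ→ℚ b
ℕ→ℚ-+ a b rewrite ℕ→ℚ≡mkℚ a | ℕ→ℚ≡mkℚ b =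
  ℚP./-cong {p₁ = + (a ℕ.+ b)} (sym (cong₂ ℤ._+_ (ℤP.*-identityʳ (+ a)) (ℤP.*-identityʳ (+ b)))) refl

ℕ→ℚ-mono-≤ : ∀ {a b} → a ≤ b → ℕ→ℚ a ℚ.≤ ℕ→ℚ b
ℕ→ℚ-mono-≤ {a} {b} a≤b rewrite ℕ→ℚ≡mkℚ a | ℕ→ℚ≡mkℚ b =
  *≤* (subst₂ ℤ._≤_ (sym (ℤP.*-identityʳ (+ a))) (sym (ℤP.*-identityʳ (+ b))) (ℤ.+≤+ a≤b))

ℕ→ℚ-∸ : ∀ {a b} → b ≤ a → ℕ→ℚ (a ∸ b) ≡ ℕ→ℚ a ℚ.- ℕ→ℚ b
ℕ→ℚ-∸ {a} {b} b≤a = begin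
  ℕ→ℚ (a ∸ b)                        ≡⟨ solve 2 (λ x y → x := (x :+ y) :- y) refl (ℕ→ℚ (a ∸ b)) (ℕ→ℚ b) ⟩
  (ℕ→ℚ (a ∸ b) ℚ.+ ℕ→ℚ b) ℚ.- ℕ→ℚ b  ≡⟨ cong (ℚ._- ℕ→ℚ b) (sym (ℕ→ℚ-+ (a ∸ b) b)) ⟩
  ℕ→ℚ (a ∸ b ℕ.+ b) ℚ.- ℕ→ℚ b        ≡⟨ cong (λ c → ℕ→ℚ c ℚ.- ℕ→ℚ b) (ℕP.m∸n+n≡m b≤a) ⟩
  ℕ→ℚ a ℚ.- ℕ→ℚ b                    ∎
  where open ≡-Reasoning

0⊔[a-b]≡a∸b : ∀ a b → 0ℚ ⊔ (ℕ→ℚ a ℚ.- ℕ→ℚ b) ≡ ℕ→ℚ (a ∸ b)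
0⊔[a-b]≡a∸b a b with ℕP.≤-total b a
... | inj₁ b≤a = trans (cong (0ℚ ⊔_) (sym (ℕ→ℚ-∸ b≤a))) (ℚP.p≤q⇒p⊔q≡q (ℕ→ℚ-mono-≤ {0} {a ∸ b} z≤n))
... | inj₂ a≤b = trans (ℚP.p≥q⇒p⊔q≡p a-b≤0) (cong ℕ→ℚ (sym (ℕP.m≤n⇒m∸n≡0 a≤b)))
  where
  a-b≡-[b∸a] : ℕ→ℚ a ℚ.- ℕ→ℚ b ≡ ℚ.- ℕ→ℚ (b ∸ a)
  a-b≡-[b∸a] = trans (solve 2 (λ x y → x :- y := :- (y :- x)) refl (ℕ→ℚ a) (ℕ→ℚ b))
                     (cong ℚ.-_ (sym (ℕ→ℚ-∸ a≤b)))
  a-b≤0 : ℕ→ℚ a ℚ.- ℕ→ℚ b ℚ.≤ 0ℚ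
  a-b≤0 = subst (ℚ._≤ 0ℚ) (sym a-b≡-[b∸a]) (ℚP.neg-antimono-≤ (ℕ→ℚ-mono-≤ {0} {b ∸ a} z≤n))

a⊓b≡a-[a∸b] : ∀ a b → ℕ→ℚ a ⊓ ℕ→ℚ b ≡ ℕ→ℚ a ℚ.- ℕ→ℚ (a ∸ b)
a⊓b≡a-[a∸b] a b with ℕP.≤-total a b
... | inj₁ a≤b = begin
  ℕ→ℚ a ⊓ ℕ→ℚ b          ≡⟨ ℚP.p≤q⇒p⊓q≡p (ℕ→ℚ-mono-≤ a≤b) ⟩
  ℕ→ℚ a                  ≡⟨ solve 1 (λ x → x := x :- con 0ℚ) refl (ℕ→ℚ a) ⟩
  ℕ→ℚ a ℚ.- ℕ→ℚ 0        ≡⟨ cong (λ c → ℕ→ℚ a ℚ.- ℕ→ℚ c) (sym (ℕP.m≤n⇒m∸n≡0 a≤b)) ⟩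
  ℕ→ℚ a ℚ.- ℕ→ℚ (a ∸ b)  ∎
  where open ≡-Reasoning
... | inj₂ b≤a = begin
  ℕ→ℚ a ⊓ ℕ→ℚ b                  ≡⟨ ℚP.p≥q⇒p⊓q≡q (ℕ→ℚ-mono-≤ b≤a) ⟩
  ℕ→ℚ b                          ≡⟨ solve 2 (λ x y → y := x :- (x :- y)) refl (ℕ→ℚ a) (ℕ→ℚ b) ⟩
  ℕ→ℚ a ℚ.- (ℕ→ℚ a ℚ.- ℕ→ℚ b)    ≡⟨ cong (λ c → ℕ→ℚ a ℚ.- c) (sym (ℕ→ℚ-∸ b≤a)) ⟩
  ℕ→ℚ a ℚ.- ℕ→ℚ (a ∸ b)          ∎
  where open ≡-Reasoning

k/n*n≡k : ∀ k n → (+ k ℚ./ suc n) ℚ.* ℕ→ℚ (suc n) ≡ ℕ→ℚ k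
k/n*n≡k k n = ℚP.toℚᵘ-injective (begin
  ℚ.toℚᵘ ((+ k ℚ./ suc n) ℚ.* ℕ→ℚ (suc n))
    ≈⟨ ℚP.toℚᵘ-homo-* (+ k ℚ./ suc n) (ℕ→ℚ (suc n)) ⟩
  ℚ.toℚᵘ (+ k ℚ./ suc n) ℚᵘ.* ℚ.toℚᵘ (ℕ→ℚ (suc n))
    ≈⟨ ℚᵘP.*-cong (ℚP.toℚᵘ-fromℚᵘ (ℚᵘ.mkℚᵘ (+ k) n))
                  (ℚᵘP.≃-reflexive (cong ℚ.toℚᵘ (ℕ→ℚ≡mkℚ (suc n)))) ⟩
  ℚᵘ.mkℚᵘ (+ k) n ℚᵘ.* ℚᵘ.mkℚᵘ (+ suc n) 0
    ≈⟨ ℚᵘ.*≡* (trans (ℤP.*-identityʳ (+ k ℤ.* + suc n))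
                     (cong (λ d → + k ℤ.* + d) (sym (ℕP.*-identityʳ (suc n))))) ⟩
  ℚᵘ.mkℚᵘ (+ k) 0
    ≡⟨ cong ℚ.toℚᵘ (sym (ℕ→ℚ≡mkℚ k)) ⟩
  ℚ.toℚᵘ (ℕ→ℚ k)
    ∎)
  where open ℚᵘP.≃-Reasoning

module _ {a ℓ} (M : Monoid a ℓ) where
  open Monoid M using (Carrier; _∙_; ε)
  open MonoidSum M using (sum)

  foldr-map≡sum∘lookup : ∀ {A : Set} (f : A → Carrier) xs →
                         foldr _∙_ ε (map f xs) ≡ sum (f ∘ List.lookup xs)
  foldr-map≡sum∘lookup f []       = refl
  foldr-map≡sum∘lookup f (x ∷ xs) = cong (f x ∙_) (foldr-map≡sum∘lookup f xs)

  foldr-tabulate≡sum : ∀ {n} (f : Fin n → Carrier) → foldr _∙_ ε (List.tabulate f) ≡ sum f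
  foldr-tabulate≡sum {zero}  f = refl
  foldr-tabulate≡sum {suc n} f = cong (f zero ∙_) (foldr-tabulate≡sum (f ∘ suc))

  foldr-map-allFin≡sum : ∀ {n} (f : Fin n → Carrier) → foldr _∙_ ε (map f (allFin n)) ≡ sum f
  foldr-map-allFin≡sum f =
    trans (cong (foldr _∙_ ε) (ListP.map-tabulate (λ i → i) f)) (foldr-tabulate≡sum f)

module ℚΣ = SemiringSum (CommutativeRing.semiring ℚ-ring)

sumℚ-allFin : ∀ {n} (f : Fin n → ℚ) → sumℚ (map f (allFin n)) ≡ ℚΣ.sum f
sumℚ-allFin = foldr-map-allFin≡sum ℚP.+-0-monoid

sum-+-* : ∀ {n} (f g : Fin n → ℚ) α →
          ℚΣ.sum (λ i → f i ℚ.+ α ℚ.* g i) ≡ ℚΣ.sum f ℚ.+ α ℚ.* ℚΣ.sum g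
sum-+-* f g α = trans (ℚΣ.∑-distrib-+ f (λ i → α ℚ.* g i))
                      (cong (ℚΣ.sum f ℚ.+_) (sym (ℚΣ.*-distribˡ-sum α g)))

dot-+-* : ∀ {n} (u v v′ : Fin n → ℚ) α →
          dot u (λ i → v i ℚ.+ α ℚ.* v′ i) ≡ dot u v ℚ.+ α ℚ.* dot u v′
dot-+-* u v v′ α = begin
  dot u (λ i → v i ℚ.+ α ℚ.* v′ i)
    ≡⟨ sumℚ-allFin (λ i → u i ℚ.* (v i ℚ.+ α ℚ.* v′ i)) ⟩
  ℚΣ.sum (λ i → u i ℚ.* (v i ℚ.+ α ℚ.* v′ i))
    ≡⟨ ℚΣ.sum-cong-≗ {x = λ i → u i ℚ.* (v i ℚ.+ α ℚ.* v′ i)} distrib ⟩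
  ℚΣ.sum (λ i → uv i ℚ.+ α ℚ.* uv′ i)
    ≡⟨ sum-+-* uv uv′ α ⟩
  ℚΣ.sum uv ℚ.+ α ℚ.* ℚΣ.sum uv′
    ≡⟨ sym (cong₂ (λ s t → s ℚ.+ α ℚ.* t) (sumℚ-allFin uv) (sumℚ-allFin uv′)) ⟩
  dot u v ℚ.+ α ℚ.* dot u v′
    ∎
  where
  open ≡-Reasoning
  uv uv′ : Fin _ → ℚ
  uv i = u i ℚ.* v i
  uv′ i = u i ℚ.* v′ i
  distrib : ∀ i → u i ℚ.* (v i ℚ.+ α ℚ.* v′ i) ≡ uv i ℚ.+ α ℚ.* uv′ i
  distrib i = solve 4 (λ x y z a → x :* (y :+ a :* z) := x :* y :+ a :* (x :* z)) refl (u i) (v i) (v′ i) α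

sum-e : ∀ {n} (S : Subset n) → ℚΣ.sum (e S) ≡ ℕ→ℚ ∣ S ∣
sum-e []          = refl
sum-e (true ∷ S)  = trans (cong (1ℚ ℚ.+_) (sum-e S)) (sym (ℕ→ℚ-+ 1 ∣ S ∣))
sum-e (false ∷ S) = trans (ℚP.+-identityˡ _) (sum-e S)

e-∩ : ∀ {n} (S U : Subset n) i → e S i ℚ.* e U i ≡ e (S ∩ U) i
e-∩ S U i rewrite VecP.lookup-zipWith _∧_ i S U with lookup S i | lookup U i
... | true  | true  = refl
... | true  | false = refl
... | false | true  = refl
... | false | false = refl

dot-e-e : ∀ {n} (S U : Subset n) → dot (e S) (e U) ≡ ℕ→ℚ ∣ S ∩ U ∣
dot-e-e S U = trans (sumℚ-allFin (λ i → e S i ℚ.* e U i))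
                    (trans (ℚΣ.sum-cong-≗ (e-∩ S U)) (sum-e (S ∩ U)))

∣p∣+∣q∣≤n+∣p∩q∣ : ∀ {n} (p q : Subset n) → ∣ p ∣ ℕ.+ ∣ q ∣ ≤ n ℕ.+ ∣ p ∩ q ∣
∣p∣+∣q∣≤n+∣p∩q∣ []          []          = z≤n
∣p∣+∣q∣≤n+∣p∩q∣ {suc n} (true ∷ p) (true ∷ q)
  rewrite ℕP.+-suc ∣ p ∣ ∣ q ∣ | ℕP.+-suc n ∣ p ∩ q ∣ = s≤s (s≤s (∣p∣+∣q∣≤n+∣p∩q∣ p q))
∣p∣+∣q∣≤n+∣p∩q∣ (true ∷ p)  (false ∷ q) = s≤s (∣p∣+∣q∣≤n+∣p∩q∣ p q)
∣p∣+∣q∣≤n+∣p∩q∣ (false ∷ p) (true ∷ q)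
  rewrite ℕP.+-suc ∣ p ∣ ∣ q ∣ = s≤s (∣p∣+∣q∣≤n+∣p∩q∣ p q)
∣p∣+∣q∣≤n+∣p∩q∣ (false ∷ p) (false ∷ q) = ℕP.m≤n⇒m≤1+n (∣p∣+∣q∣≤n+∣p∩q∣ p q)

-- U is built by spending its m elements outside S first.
minimalOverlap : ∀ {n} (S : Subset n) m → m ≤ n →
                 ∃ λ U → ∣ U ∣ ≡ m × ∣ S ∩ U ∣ ≡ (∣ S ∣ ℕ.+ m) ∸ n
minimalOverlap [] zero _ = [] , refl , refl
minimalOverlap {suc n} (true ∷ S) m m≤1+n with ℕP.m≤n⇒m<n∨m≡n m≤1+n
... | inj₁ (s≤s m≤n) with minimalOverlap S m m≤n
...   | U , ∣U∣≡m , ∣S∩U∣≡ = false ∷ U , ∣U∣≡m , ∣S∩U∣≡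
minimalOverlap {suc n} (true ∷ S) _ _ | inj₂ refl =
  ⊤ , SubsetP.∣⊤∣≡n (suc n) ,
  trans (cong ∣_∣ (SubsetP.∩-identityʳ (true ∷ S))) (sym (ℕP.m+n∸n≡m (suc ∣ S ∣) (suc n)))
minimalOverlap {suc n} (false ∷ S) zero _ with minimalOverlap S zero z≤n
... | U , ∣U∣≡0 , ∣S∩U∣≡ =
  false ∷ U , ∣U∣≡0 , trans ∣S∩U∣≡ (trans (ℕP.m≤n⇒m∸n≡0 S+0≤n) (sym (ℕP.m≤n⇒m∸n≡0 (ℕP.m≤n⇒m≤1+n S+0≤n))))
  where
  S+0≤n : ∣ S ∣ ℕ.+ 0 ≤ n
  S+0≤n = subst (_≤ n) (sym (ℕP.+-identityʳ ∣ S ∣)) (SubsetP.∣p∣≤n S)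
minimalOverlap {suc n} (false ∷ S) (suc m) (s≤s m≤n) with minimalOverlap S m m≤n
... | U , ∣U∣≡m , ∣S∩U∣≡ =
  true ∷ U , cong suc ∣U∣≡m , trans ∣S∩U∣≡ (cong (_∸ suc n) (sym (ℕP.+-suc ∣ S ∣ m)))

∈-allSubsets : ∀ {n} (U : Subset n) → U ∈ allSubsets n
∈-allSubsets []          = here refl
∈-allSubsets (true ∷ U)  = ∈-++⁺ˡ (∈-map⁺ (true ∷_) (∈-allSubsets U))
∈-allSubsets {suc n} (false ∷ U) =
  ∈-++⁺ʳ (map (true ∷_) (allSubsets n)) (∈-map⁺ (false ∷_) (∈-allSubsets U))

-- The filter inside `subsetsOfSize` is local to its definition; the
-- metavariable `sizeFilter` is solved to it by the with-abstraction below.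
mutual
  private
    sizeFilter : (n m : ℕ) → List (Subset n) → List (Subset n)
    sizeFilter n m = _

  subsetsOfSize≡sizeFilter : ∀ n m → subsetsOfSize n m ≡ sizeFilter n m (allSubsets n)
  subsetsOfSize≡sizeFilter n m with allSubsets n
  ... | _ = refl

sizeFilter≡filter : ∀ n m xs → sizeFilter n m xs ≡ filter (λ U → ∣ U ∣ ≟ m) xs
sizeFilter≡filter n m []       = refl
sizeFilter≡filter n m (x ∷ xs) with ∣ x ∣ ≡ᵇ m
... | true  = cong (x ∷_) (sizeFilter≡filter n m xs)
... | false = sizeFilter≡filter n m xs

subsetsOfSize≡filter : ∀ n m → subsetsOfSize n m ≡ filter (λ U → ∣ U ∣ ≟ m) (allSubsets n)
subsetsOfSize≡filter n m = trans (subsetsOfSize≡sizeFilter n m) (sizeFilter≡filter n m (allSubsets n))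

∈-subsetsOfSize⁺ : ∀ {n m} {U : Subset n} → ∣ U ∣ ≡ m → U ∈ subsetsOfSize n m
∈-subsetsOfSize⁺ {n} {m} {U} ∣U∣≡m =
  subst (U ∈_) (sym (subsetsOfSize≡filter n m)) (∈-filter⁺ (λ V → ∣ V ∣ ≟ m) (∈-allSubsets U) ∣U∣≡m)

∈-subsetsOfSize⁻ : ∀ {n m} {U : Subset n} → U ∈ subsetsOfSize n m → ∣ U ∣ ≡ m
∈-subsetsOfSize⁻ {n} {m} {U} U∈ =
  proj₂ (∈-filter⁻ (λ V → ∣ V ∣ ≟ m) {xs = allSubsets n} (subst (U ∈_) (subsetsOfSize≡filter n m) U∈))

minℚ≡v⁺ : ∀ {v xs} → v ∈ xs → All (v ℚ.≤_) xs → minℚ xs ≡ v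
minℚ≡v⁺ {v} {x ∷ xs} v∈x∷xs (v≤x All.∷ v≤xs) = ℚP.≤-antisym min≤v v≤min
  where
  min≤v : foldr _⊓_ x xs ℚ.≤ v
  min≤v = ListP.foldr-preservesᵒ (λ p q → [ ℚP.p≤q⇒p⊓r≤q q , ℚP.p≤q⇒r⊓p≤q p ]) x xs (witness v∈x∷xs)
    where
    witness : v ∈ x ∷ xs → x ℚ.≤ v ⊎ Any.Any (ℚ._≤ v) xs
    witness (here refl)  = inj₁ ℚP.≤-refl
    witness (there v∈xs) = inj₂ (Any.map (λ { refl → ℚP.≤-refl }) v∈xs)
  v≤min : v ℚ.≤ foldr _⊓_ x xs
  v≤min = ListP.foldr-preservesᵇ ℚP.⊓-glb v≤x v≤xs

minimumOverlap : ∀ {n m} (S : Subset n) → m ≤ n →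
                 minℚ (map (λ U → dot (e S) (e U)) (subsetsOfSize n m)) ≡ ℕ→ℚ ((∣ S ∣ ℕ.+ m) ∸ n)
minimumOverlap {n} {m} S m≤n with minimalOverlap S m m≤n
... | U₀ , ∣U₀∣≡m , ∣S∩U∣≡ = minℚ≡v⁺ attained bounded
  where
  attained : ℕ→ℚ ((∣ S ∣ ℕ.+ m) ∸ n) ∈ map (λ U → dot (e S) (e U)) (subsetsOfSize n m)
  attained = subst (_∈ map (λ U → dot (e S) (e U)) (subsetsOfSize n m))
                   (trans (dot-e-e S U₀) (cong ℕ→ℚ ∣S∩U∣≡))
                   (∈-map⁺ (λ U → dot (e S) (e U)) (∈-subsetsOfSize⁺ {U = U₀} ∣U₀∣≡m))
  bound : ∀ {U} → U ∈ subsetsOfSize n m → ℕ→ℚ ((∣ S ∣ ℕ.+ m) ∸ n) ℚ.≤ dot (e S) (e U)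
  bound {U} U∈ rewrite dot-e-e S U | sym (∈-subsetsOfSize⁻ U∈) =
    ℕ→ℚ-mono-≤ (ℕP.m≤n+o⇒m∸n≤o (∣ S ∣ ℕ.+ ∣ U ∣) n (∣p∣+∣q∣≤n+∣p∩q∣ S U))
  bounded : All (ℕ→ℚ ((∣ S ∣ ℕ.+ m) ∸ n) ℚ.≤_) (map (λ U → dot (e S) (e U)) (subsetsOfSize n m))
  bounded = AllP.map⁺ (All.tabulate bound)

[s+[n∸k]]∸n≡s∸k : ∀ s {n k} → k ≤ n → (s ℕ.+ (n ∸ k)) ∸ n ≡ s ∸ k
[s+[n∸k]]∸n≡s∸k s {n} {k} k≤n = begin
  (s ℕ.+ (n ∸ k)) ∸ n   ≡⟨ cong (_∸ n) (sym (ℕP.+-∸-assoc s k≤n)) ⟩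
  (s ℕ.+ n) ∸ k ∸ n     ≡⟨ ℕP.∸-+-assoc (s ℕ.+ n) k n ⟩
  (s ℕ.+ n) ∸ (k ℕ.+ n) ≡⟨ cong₂ _∸_ (ℕP.+-comm s n) (ℕP.+-comm k n) ⟩
  (n ℕ.+ s) ∸ (n ℕ.+ k) ≡⟨ ℕP.[m+n]∸[m+o]≡n∸o n s k ⟩
  s ∸ k                 ∎
  where open ≡-Reasoning

γcoeff≡dot-∣S∣∸k : ∀ n k w S → k ≤ suc n → γcoeff n k w S ≡ dot (e S) w ℚ.- ℕ→ℚ (∣ S ∣ ∸ k)
γcoeff≡dot-∣S∣∸k n k w S k≤1+n = begin
  ℚ.- (minℚ (map (λ U → dot (e S) (e U)) (subsetsOfSize (suc n) (suc n ∸ k))) ℚ.- dot (e S) w)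
    ≡⟨ cong (λ t → ℚ.- (t ℚ.- dot (e S) w)) (minimumOverlap S (ℕP.m∸n≤m (suc n) k)) ⟩
  ℚ.- (ℕ→ℚ ((∣ S ∣ ℕ.+ (suc n ∸ k)) ∸ suc n) ℚ.- dot (e S) w)
    ≡⟨ cong (λ t → ℚ.- (ℕ→ℚ t ℚ.- dot (e S) w)) ([s+[n∸k]]∸n≡s∸k ∣ S ∣ k≤1+n) ⟩
  ℚ.- (ℕ→ℚ (∣ S ∣ ∸ k) ℚ.- dot (e S) w)
    ≡⟨ solve 2 (λ t d → :- (t :- d) := d :- t) refl (ℕ→ℚ (∣ S ∣ ∸ k)) (dot (e S) w) ⟩
  dot (e S) w ℚ.- ℕ→ℚ (∣ S ∣ ∸ k) ∎
  where open ≡-Reasoning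

module ChowModelSums {N} {M : Matroid N} {R : CommutativeRing 0ℓ 0ℓ} (mdl : ChowModel M R) where
  open CommutativeRing R hiding (refl; sym; trans; reflexive; zero)
  module R = CommutativeRing R
  open ChowModel mdl
  open RingMorphisms (CommutativeRing.rawRing ℚ-ring) rawRing
  open IsRingHomomorphism ι-hom
  open SemiringSum semiring
  open ≈-Reasoning setoid

  private
    J : ℕ
    J = length (nonemptyProperSubsets N)
    subset : Fin J → Subset N
    subset = List.lookup (nonemptyProperSubsets N)

    through : Fin N → Fin J → Carrier
    through i j = if lookup (subset j) i then x (subset j) else 0#

  xThrough : Fin N → Carrier
  xThrough i = ∑[ j < J ] through i j

  xThrough-indep : ∀ i i′ → xThrough i ≈ xThrough i′
  xThrough-indep i i′ = subst₂ _≈_ (foldr-map≡sum∘lookup +-monoid _ (nonemptyProperSubsets N))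
                                   (foldr-map≡sum∘lookup +-monoid _ (nonemptyProperSubsets N))
                                   (linear i i′)

  evalLin≡sum : ∀ c → evalLin mdl c ≡ ∑[ j < J ] (ι (c (subset j)) * x (subset j))
  evalLin≡sum c = foldr-map≡sum∘lookup +-monoid _ (nonemptyProperSubsets N)

  evalLin-cong : ∀ {c d} → (∀ S → c S ≡ d S) → evalLin mdl c ≡ evalLin mdl d
  evalLin-cong c≗d =
    cong (foldr _+_ 0#) (ListP.map-cong (λ S → cong (λ q → ι q * x S) (c≗d S)) (nonemptyProperSubsets N))

  evalLin-+ : ∀ c d → evalLin mdl (λ S → c S ℚ.+ d S) ≈ evalLin mdl c + evalLin mdl d
  evalLin-+ c d = begin
    evalLin mdl (λ S → c S ℚ.+ d S)
      ≡⟨ evalLin≡sum _ ⟩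
    ∑[ j < J ] (ι (c (subset j) ℚ.+ d (subset j)) * x (subset j))
      ≈⟨ sum-cong-≋ (λ j → ι-+-* (subset j)) ⟩
    ∑[ j < J ] (cx j + dx j)
      ≈⟨ ∑-distrib-+ cx dx ⟩
    ∑[ j < J ] cx j + ∑[ j < J ] dx j
      ≡⟨ sym (cong₂ _+_ (evalLin≡sum c) (evalLin≡sum d)) ⟩
    evalLin mdl c + evalLin mdl d
      ∎
    where
    ι-+-* : ∀ S → ι (c S ℚ.+ d S) * x S ≈ ι (c S) * x S + ι (d S) * x S
    ι-+-* S = R.trans (*-congʳ (+-homo (c S) (d S))) (distribʳ (x S) (ι (c S)) (ι (d S)))
    cx dx : Fin J → Carrier
    cx j = ι (c (subset j)) * x (subset j)
    dx j = ι (d (subset j)) * x (subset j)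

  ι-sum : ∀ {n} (a : Fin n → ℚ) → ι (ℚΣ.sum a) ≈ ∑[ i < n ] ι (a i)
  ι-sum {zero}  a = 0#-homo
  ι-sum {suc n} a = R.trans (+-homo (a zero) _) (+-congˡ (ι-sum (a ∘ suc)))

  ι-e*-x : ∀ S (a : Fin N → ℚ) i → ι (e S i ℚ.* a i) * x S ≈ ι (a i) * (if lookup S i then x S else 0#)
  ι-e*-x S a i with lookup S i
  ... | true  = *-congʳ (R.reflexive (cong ι (ℚP.*-identityˡ (a i))))
  ... | false = begin
    ι (0ℚ ℚ.* a i) * x S ≡⟨ cong (λ q → ι q * x S) (ℚP.*-zeroˡ (a i)) ⟩
    ι 0ℚ * x S           ≈⟨ *-congʳ 0#-homo ⟩
    0# * x S             ≈⟨ zeroˡ _ ⟩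
    0#                   ≈⟨ R.sym (zeroʳ _) ⟩
    ι (a i) * 0#         ∎

  evalLin-dot : ∀ a → evalLin mdl (λ S → dot (e S) a) ≈ ∑[ i < N ] (ι (a i) * xThrough i)
  evalLin-dot a = begin
    evalLin mdl (λ S → dot (e S) a)
      ≡⟨ evalLin≡sum _ ⟩
    ∑[ j < J ] (ι (dot (e (subset j)) a) * x (subset j))
      ≈⟨ sum-cong-≋ (λ j → *-congʳ (ι-dot (subset j))) ⟩
    ∑[ j < J ] ((∑[ i < N ] ι (e (subset j) i ℚ.* a i)) * x (subset j))
      ≈⟨ sum-cong-≋ (λ j → *-distribʳ-sum (x (subset j)) (λ i → ι (e (subset j) i ℚ.* a i))) ⟩
    ∑[ j < J ] ∑[ i < N ] (ι (e (subset j) i ℚ.* a i) * x (subset j))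
      ≈⟨ sum-cong-≋ (λ j → sum-cong-≋ (ι-e*-x (subset j) a)) ⟩
    ∑[ j < J ] ∑[ i < N ] (ι (a i) * through i j)
      ≈⟨ ∑-comm (λ j i → ι (a i) * through i j) ⟩
    ∑[ i < N ] ∑[ j < J ] (ι (a i) * through i j)
      ≈⟨ sum-cong-≋ (λ i → R.sym (*-distribˡ-sum (ι (a i)) (through i))) ⟩
    ∑[ i < N ] (ι (a i) * xThrough i)
      ∎
    where
    ι-dot : ∀ S → ι (dot (e S) a) ≈ ∑[ i < N ] ι (e S i ℚ.* a i)
    ι-dot S = R.trans (R.reflexive (cong ι (sumℚ-allFin (λ i → e S i ℚ.* a i))))
                      (ι-sum (λ i → e S i ℚ.* a i))

  evalLin-dot≈0 : ∀ a → Fin N → ℚΣ.sum a ≡ 0ℚ → evalLin mdl (λ S → dot (e S) a) ≈ 0#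
  evalLin-dot≈0 a i₀ Σa≡0 = begin
    evalLin mdl (λ S → dot (e S) a)    ≈⟨ evalLin-dot a ⟩
    ∑[ i < N ] (ι (a i) * xThrough i)  ≈⟨ sum-cong-≋ (λ i → *-congˡ (xThrough-indep i i₀)) ⟩
    ∑[ i < N ] (ι (a i) * xThrough i₀) ≈⟨ R.sym (*-distribʳ-sum (xThrough i₀) (λ i → ι (a i))) ⟩
    (∑[ i < N ] ι (a i)) * xThrough i₀ ≈⟨ *-congʳ (R.sym (ι-sum a)) ⟩
    ι (ℚΣ.sum a) * xThrough i₀         ≡⟨ cong (λ q → ι q * xThrough i₀) Σa≡0 ⟩
    ι 0ℚ * xThrough i₀                 ≈⟨ *-congʳ 0#-homo ⟩
    0# * xThrough i₀                   ≈⟨ zeroˡ _ ⟩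
    0#                                 ∎

linearRelation⇒EqA1 : ∀ {n} {M : Matroid (suc n)} (c d : Subset (suc n) → ℚ) (a : Fin (suc n) → ℚ) →
                      (∀ S → c S ≡ d S ℚ.+ dot (e S) a) → ℚΣ.sum a ≡ 0ℚ → EqA1 M c d
linearRelation⇒EqA1 c d a c≡d+a Σa≡0 R mdl = begin
  evalLin mdl c                                   ≡⟨ evalLin-cong c≡d+a ⟩
  evalLin mdl (λ S → d S ℚ.+ dot (e S) a)         ≈⟨ evalLin-+ d (λ S → dot (e S) a) ⟩
  evalLin mdl d + evalLin mdl (λ S → dot (e S) a) ≈⟨ +-congˡ (evalLin-dot≈0 a zero Σa≡0) ⟩
  evalLin mdl d + 0#                              ≈⟨ +-identityʳ _ ⟩
  evalLin mdl d                                   ∎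
  where
  open CommutativeRing R using (_+_; 0#; +-congˡ; +-identityʳ; setoid)
  open ChowModelSums mdl
  open ≈-Reasoning setoid

module HypersimplexRelations (n k : ℕ) (k≤1+n : k ≤ suc n) (w : Fin (suc n) → ℚ) where
  open ≡-Reasoning

  private
    excess : Subset (suc n) → ℚ
    excess S = ℕ→ℚ (∣ S ∣ ∸ k)
    q : ℚ
    q = + k ℚ./ suc n

  shift : ℚ → Subset (suc n) → Fin (suc n) → ℚ
  shift α T i = w i ℚ.+ α ℚ.* e T i

  dot-shift : ∀ α T S → dot (e S) (shift α T) ≡ dot (e S) w ℚ.+ α ℚ.* ℕ→ℚ ∣ S ∩ T ∣
  dot-shift α T S = trans (dot-+-* (e S) w (e T) α) (cong (λ c → dot (e S) w ℚ.+ α ℚ.* c) (dot-e-e S T))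

  OI≡ : ∀ {T} → ∣ T ∣ ≡ suc n ∸ k → ∀ S → OI S T ≡ ℕ→ℚ ∣ S ∩ T ∣ ℚ.- excess S
  OI≡ {T} ∣T∣≡m S = cong (λ c → ℕ→ℚ ∣ S ∩ T ∣ ℚ.- c) (begin
    0ℚ ⊔ ((ℕ→ℚ ∣ S ∣ ℚ.+ ℕ→ℚ ∣ T ∣) ℚ.- ℕ→ℚ (suc n))
      ≡⟨ cong (λ c → 0ℚ ⊔ ((ℕ→ℚ ∣ S ∣ ℚ.+ c) ℚ.- ℕ→ℚ (suc n))) (trans (cong ℕ→ℚ ∣T∣≡m) (ℕ→ℚ-∸ k≤1+n)) ⟩
    0ℚ ⊔ ((ℕ→ℚ ∣ S ∣ ℚ.+ (ℕ→ℚ (suc n) ℚ.- ℕ→ℚ k)) ℚ.- ℕ→ℚ (suc n))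
      ≡⟨ cong (0ℚ ⊔_) (solve 3 (λ s N k → (s :+ (N :- k)) :- N := s :- k) refl
                              (ℕ→ℚ ∣ S ∣) (ℕ→ℚ (suc n)) (ℕ→ℚ k)) ⟩
    0ℚ ⊔ (ℕ→ℚ ∣ S ∣ ℚ.- ℕ→ℚ k)
      ≡⟨ 0⊔[a-b]≡a∸b ∣ S ∣ k ⟩
    excess S ∎)

  γcoeff≡OI+dot : ∀ T → ∣ T ∣ ≡ suc n ∸ k →
                  ∀ S → γcoeff n k w S ≡ OI S T ℚ.+ dot (e S) (shift (ℚ.- 1ℚ) T)
  γcoeff≡OI+dot T ∣T∣≡m S = begin
    γcoeff n k w S                                                  ≡⟨ γcoeff≡dot-∣S∣∸k n k w S k≤1+n ⟩
    dot (e S) w ℚ.- excess S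
      ≡⟨ solve 3 (λ d c u → d :- u := (c :- u) :+ (d :+ :- con 1ℚ :* c)) refl
                 (dot (e S) w) (ℕ→ℚ ∣ S ∩ T ∣) (excess S) ⟩
    (ℕ→ℚ ∣ S ∩ T ∣ ℚ.- excess S) ℚ.+ (dot (e S) w ℚ.+ ℚ.- 1ℚ ℚ.* ℕ→ℚ ∣ S ∩ T ∣)
      ≡⟨ sym (cong₂ ℚ._+_ (OI≡ ∣T∣≡m S) (dot-shift (ℚ.- 1ℚ) T S)) ⟩
    OI S T ℚ.+ dot (e S) (shift (ℚ.- 1ℚ) T)                        ∎

  γcoeff≡mult+dot : ∀ S → γcoeff n k w S ≡ mult n ∣ S ∣ k ℚ.+ dot (e S) (shift (q ℚ.- 1ℚ) ⊤)
  γcoeff≡mult+dot S = begin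
    γcoeff n k w S                                                  ≡⟨ γcoeff≡dot-∣S∣∸k n k w S k≤1+n ⟩
    dot (e S) w ℚ.- excess S
      ≡⟨ solve 4 (λ d s u r → d :- u := ((s :- u) :- r :* s) :+ (d :+ (r :- con 1ℚ) :* s)) refl
               (dot (e S) w) (ℕ→ℚ ∣ S ∣) (excess S) q ⟩
    ((ℕ→ℚ ∣ S ∣ ℚ.- excess S) ℚ.- q ℚ.* ℕ→ℚ ∣ S ∣) ℚ.+ (dot (e S) w ℚ.+ (q ℚ.- 1ℚ) ℚ.* ℕ→ℚ ∣ S ∣)
      ≡⟨ sym (cong₂ ℚ._+_ (cong (ℚ._- q ℚ.* ℕ→ℚ ∣ S ∣) (a⊓b≡a-[a∸b] ∣ S ∣ k))
                          (trans (dot-shift (q ℚ.- 1ℚ) ⊤ S)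
                                 (cong (λ c → dot (e S) w ℚ.+ (q ℚ.- 1ℚ) ℚ.* ℕ→ℚ ∣ c ∣)
                                       (SubsetP.∩-identityʳ S)))) ⟩
    mult n ∣ S ∣ k ℚ.+ dot (e S) (shift (q ℚ.- 1ℚ) ⊤)               ∎

  module _ (Σw≡m : sumℚ (map w (allFin (suc n))) ≡ ℕ→ℚ (suc n ∸ k)) where

    sum-shift : ∀ α T → ℚΣ.sum (shift α T) ≡ ℕ→ℚ (suc n ∸ k) ℚ.+ α ℚ.* ℕ→ℚ ∣ T ∣
    sum-shift α T = trans (sum-+-* w (e T) α)
      (cong₂ (λ s c → s ℚ.+ α ℚ.* c) (trans (sym (sumℚ-allFin w)) Σw≡m) (sum-e T))

    sum-shift-OI : ∀ T → ∣ T ∣ ≡ suc n ∸ k → ℚΣ.sum (shift (ℚ.- 1ℚ) T) ≡ 0ℚ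
    sum-shift-OI T ∣T∣≡m = begin
      ℚΣ.sum (shift (ℚ.- 1ℚ) T)
        ≡⟨ sum-shift (ℚ.- 1ℚ) T ⟩
      ℕ→ℚ (suc n ∸ k) ℚ.+ ℚ.- 1ℚ ℚ.* ℕ→ℚ ∣ T ∣
        ≡⟨ cong (λ c → ℕ→ℚ (suc n ∸ k) ℚ.+ ℚ.- 1ℚ ℚ.* ℕ→ℚ c) ∣T∣≡m ⟩
      ℕ→ℚ (suc n ∸ k) ℚ.+ ℚ.- 1ℚ ℚ.* ℕ→ℚ (suc n ∸ k)
        ≡⟨ solve 1 (λ m → m :+ :- con 1ℚ :* m := con 0ℚ) refl (ℕ→ℚ (suc n ∸ k)) ⟩
      0ℚ
        ∎

    sum-shift-mult : ℚΣ.sum (shift (q ℚ.- 1ℚ) ⊤) ≡ 0ℚ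
    sum-shift-mult = begin
      ℚΣ.sum (shift (q ℚ.- 1ℚ) ⊤)                              ≡⟨ sum-shift (q ℚ.- 1ℚ) ⊤ ⟩
      ℕ→ℚ (suc n ∸ k) ℚ.+ (q ℚ.- 1ℚ) ℚ.* ℕ→ℚ ∣ ⊤ {suc n} ∣
        ≡⟨ cong₂ (λ m N → m ℚ.+ (q ℚ.- 1ℚ) ℚ.* ℕ→ℚ N) (ℕ→ℚ-∸ k≤1+n) (SubsetP.∣⊤∣≡n (suc n)) ⟩
      (ℕ→ℚ (suc n) ℚ.- ℕ→ℚ k) ℚ.+ (q ℚ.- 1ℚ) ℚ.* ℕ→ℚ (suc n)
        ≡⟨ solve 3 (λ N k r → (N :- k) :+ (r :- con 1ℚ) :* N := r :* N :- k) refl (ℕ→ℚ (suc n)) (ℕ→ℚ k) q ⟩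
      q ℚ.* ℕ→ℚ (suc n) ℚ.- ℕ→ℚ k                             ≡⟨ cong (ℚ._- ℕ→ℚ k) (k/n*n≡k k n) ⟩
      ℕ→ℚ k ℚ.- ℕ→ℚ k                                          ≡⟨ ℚP.+-inverseʳ (ℕ→ℚ k) ⟩
      0ℚ                                                       ∎

lemma2p2 : (n r : ℕ) (M : Matroid (suc n)) → Loopless M → rk M ⊤ ≡ suc r →
           (k : ℕ) → 1 ≤ k → k ≤ n →
           (w : Fin (suc n) → ℚ) → sumℚ (map w (allFin (suc n))) ≡ ℕ→ℚ (suc n ∸ k) →
           ((T : Subset (suc n)) → ∣ T ∣ ≡ suc n ∸ k →
             EqA1 M (γcoeff n k w) (λ S → OI S T))
           × EqA1 M (γcoeff n k w) (λ S → mult n ∣ S ∣ k)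
lemma2p2 n r M _ _ k _ k≤n w Σw≡m =
  (λ T ∣T∣≡m → linearRelation⇒EqA1 _ _ _ (γcoeff≡OI+dot T ∣T∣≡m) (sum-shift-OI Σw≡m T ∣T∣≡m)) ,
  linearRelation⇒EqA1 _ _ _ γcoeff≡mult+dot (sum-shift-mult Σw≡m)
  where open HypersimplexRelations n k (ℕP.m≤n⇒m≤1+n k≤n) w
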